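{- For every integer $k\ge 2$, $$F_v(J_k,J_k;k)\le\left\lceil \frac{5F_v(k-1,k-1;k)}{2}\right\rceil.$$
   Context: $J_k=K_k-e$, the complete graph on $k$ vertices with one edge removed. For graphs $G,H_1,H_2$, $G\rightarrow(H_1,H_2)^v$ means that for every partition $V(G)=X_1\cup X_2$ there is $i$ such that the subgraph induced by $X_i$ contains a copy of $H_i$. An integer $a$ in place of a graph stands for $K_a$. $F_v(H_1,H_2;m)$ is the smallest number of vertices of a $K_m$-free graph $G$ with $G\rightarrow(H_1,H_2)^v$. -}

module Defs where

open import Data.Nat using (ℕ; zero; suc; _+_; _*_; _≤_)
open import Data.Nat.DivMod using (_/_)
open import Data.Fin using (Fin; toℕ)
open import Data.Bool using (Bool; true; false)
open import Data.Product using (Σ; _×_; ∃)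
open import Data.Sum using (_⊎_)
open import Relation.Binary.PropositionalEquality using (_≡_; _≢_)
open import Relation.Nullary using (¬_)
open import Function.Definitions using (Injective)

record Graph (n : ℕ) : Set₁ where
  field
    Adj   : Fin n → Fin n → Set
    sym   : ∀ {i j} → Adj i j → Adj j i
    irrefl : ∀ {i} → ¬ Adj i i
open Graph public

K : (a : ℕ) → Graph a
K a = record { Adj = λ i j → i ≢ j ; sym = λ p q → p (Relation.Binary.PropositionalEquality.sym q)
             ; irrefl = λ p → p Relation.Binary.PropositionalEquality.refl }
  where import Relation.Binary.PropositionalEquality

IsEdge01 : ∀ {k} → Fin k → Fin k → Set
IsEdge01 i j = (toℕ i ≡ 0 × toℕ j ≡ 1) ⊎ (toℕ i ≡ 1 × toℕ j ≡ 0)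

-- J_k = K_k - e (used for k ≥ 2), with e = {0,1}.
J : (k : ℕ) → Graph k
J k = record
  { Adj = λ i j → i ≢ j × ¬ IsEdge01 i j
  ; sym = λ { (p , q) → (λ e → p (≡sym e)) , (λ r → q (swap01 r)) }
  ; irrefl = λ { (p , _) → p refl } }
  where
    open import Data.Product using (_,_)
    open import Data.Sum using (inj₁; inj₂)
    open import Relation.Binary.PropositionalEquality using (refl) renaming (sym to ≡sym)
    swap01 : ∀ {i j} → IsEdge01 {k} j i → IsEdge01 {k} i j
    swap01 (inj₁ (a , b)) = inj₂ (b , a)
    swap01 (inj₂ (a , b)) = inj₁ (b , a)

ContainsIn : ∀ {n h} → Graph n → Graph h → (Fin n → Set) → Set
ContainsIn {n} {h} G H X =
  Σ (Fin h → Fin n) λ f →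
    Injective _≡_ _≡_ f × (∀ a → X (f a)) × (∀ a b → Adj H a b → Adj G (f a) (f b))

Contains : ∀ {n h} → Graph n → Graph h → Set
Contains G H = ContainsIn G H (λ _ → Data.Unit.⊤)
  where import Data.Unit

Free : ℕ → ∀ {n} → Graph n → Set
Free m G = ¬ Contains G (K m)

-- G → (H₁ , H₂)^v : for every partition V(G) = X₁ ∪ X₂ (given by a
-- 2-colouring c, X₁ = c⁻¹(true), X₂ = c⁻¹(false)) some X_i contains H_i.
Arrows : ∀ {n h₁ h₂} → Graph n → Graph h₁ → Graph h₂ → Set
Arrows G H₁ H₂ =
  ∀ (c : _ → Bool) → ContainsIn G H₁ (λ v → c v ≡ true) ⊎ ContainsIn G H₂ (λ v → c v ≡ false)

IsFv : ∀ {h₁ h₂} → Graph h₁ → Graph h₂ → ℕ → ℕ → Set₁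
IsFv H₁ H₂ m N =
  (Σ (Graph N) λ G → Free m G × Arrows G H₁ H₂) ×
  (∀ N' (G : Graph N') → Free m G → Arrows G H₁ H₂ → N ≤ N')

ceil5/2 : ℕ → ℕ
ceil5/2 n = (5 * n + 1) / 2

-- Let G be a K_k-free graph with G → (K_{k-1}, K_{k-1})^v on n = F_v(k-1,k-1;k) vertices.
-- Blow it up to 2n+1 vertices: two non-adjacent copies of every vertex and a third copy of
-- vertex 0. The blow-up is still K_k-free, and by minimality G − 0 has a 2-colouring d with no
-- monochromatic K_{k-1}. Given a 2-colouring of the blow-up, colour a vertex v of G by a colour
-- occurring twice over v if there is one, and otherwise (then v ≠ 0 and its two copies differ)
-- by d v. A monochromatic K_{k-1} in G cannot lie in G − 0 with all colours given by d, so one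
-- of its vertices has two lifts of its colour; these non-adjacent lifts and lifts of the other
-- clique vertices form a monochromatic J_k. So F_v(J_k,J_k;k) ≤ 2n+1 ≤ ⌈5n/2⌉, where F_v exists
-- because its defining property is decidable on Boolean adjacency matrices.
module Submission where

open import Defs
open import Data.Nat using (ℕ; _≤_; _∸_)
open import Data.Product using (Σ; _×_)

open import Data.Bool using (Bool; true; false; T)
open import Data.Bool.Properties using (T?; ¬-not) renaming (_≟_ to _≟B_)
open import Data.Empty using (⊥-elim)
open import Data.Fin using (Fin; zero; suc; toℕ; punchIn; combine; remainder)
open import Data.Fin.Patterns using (0F; 1F)
open import Data.Fin.Properties
  using (¬Fin0; any?; all?; _≟_; suc-injective; punchIn-injective; punchInᵢ≢i;
         remQuot-combine; combine-injectiveˡ)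
open import Data.Nat using (zero; suc; z≤n; s≤s; s≤s⁻¹; _≤?_; _+_; _*_)
open import Data.Nat.DivMod using (_/_; m*n/n≡m; /-monoˡ-≤)
open import Data.Nat.Properties
  using (≤-refl; ≤-trans; m≤n⇒m≤1+n; ≮⇒≥; m≤n⇒m<n∨m≡n; 1+n≰n; m≤n+m;
         module ≤-Reasoning)
  renaming (_≟_ to _≟ℕ_)
open import Data.Nat.Tactic.RingSolver using (solve-∀)
open import Data.Product using (∃; ∃₂; _,_; proj₁; proj₂; uncurry)
open import Data.Sum using (_⊎_; inj₁; inj₂; [_,_]; map)
open import Data.Unit using (⊤; tt)
open import Data.Vec.Functional using (_∷_; head; tail)
import Data.Vec.Functional.Relation.Binary.Pointwise.Properties as Pointwise
open import Function using (_∘_)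
open import Function.Definitions using (Injective)
open import Level using (0ℓ)
open import Relation.Binary using (Setoid)
open import Relation.Binary.Definitions using (_Respects_)
open import Relation.Binary.PropositionalEquality
  using (_≡_; _≢_; refl; trans; cong; subst; subst₂)
import Relation.Binary.PropositionalEquality as ≡
open import Relation.Nullary using (¬_; Dec; yes; no)
open import Relation.Nullary.Decidable
  using (isYes; toWitness; fromWitness; _⊎-dec_; _×-dec_; _→-dec_; ¬?;
         decidable-stable; ¬¬-excluded-middle)
import Relation.Nullary.Decidable as Dec
open import Relation.Nullary.Negation using (¬¬-map)
open import Relation.Unary using (Pred; Decidable)

-- Only predicates respecting ≈ need to be searched; this is what makes Fin n → A searchable
-- without function extensionality.
record Exhaustible (S : Setoid 0ℓ 0ℓ) : Set₁ where
  open Setoid S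
  field
    search : ∀ {P : Pred Carrier 0ℓ} → P Respects _≈_ → Decidable P → Dec (∃ P)
open Exhaustible

Bool-exhaustible : Exhaustible (≡.setoid Bool)
search Bool-exhaustible _ P? = Dec.map′ from to (P? true ⊎-dec P? false)
  where
    from : _ ⊎ _ → ∃ _
    from (inj₁ p) = true , p
    from (inj₂ p) = false , p
    to : ∃ _ → _ ⊎ _
    to (true , p) = inj₁ p
    to (false , p) = inj₂ p

Fin-exhaustible : ∀ {n} → Exhaustible (≡.setoid (Fin n))
search Fin-exhaustible _ = any?

→-exhaustible : ∀ {S} → Exhaustible S → ∀ {n} → Exhaustible (Pointwise.setoid S n)
search (→-exhaustible {S} A {zero}) resp P? =
  Dec.map′ (λ p → empty , p) (λ (f , p) → resp {f} (λ ()) p) (P? empty)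
  where
    empty : Fin 0 → Setoid.Carrier S
    empty ()
search (→-exhaustible {S} A {suc n}) {P} resp P? =
  Dec.map′ (λ (x , f , p) → x ∷ f , p) (λ (f , p) → head f , tail f , resp η p)
    (search A resp-head λ x →
      search (→-exhaustible A) (resp ∘ cons-cong ≈-refl) (P? ∘ (x ∷_)))
  where
    open Setoid S using (Carrier; _≈_) renaming (refl to ≈-refl)
    cons-cong : ∀ {x y} {f g : Fin n → Carrier} →
                x ≈ y → (∀ i → f i ≈ g i) → ∀ i → (x ∷ f) i ≈ (y ∷ g) i
    cons-cong x≈y f≈g zero = x≈y
    cons-cong x≈y f≈g (suc i) = f≈g i
    η : ∀ {f : Fin (suc n) → Carrier} → ∀ i → f i ≈ (head f ∷ tail f) i
    η zero = ≈-refl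
    η (suc i) = ≈-refl
    resp-head : (λ x → ∃ λ f → P (x ∷ f)) Respects _≈_
    resp-head x≈y (f , p) = f , resp (cons-cong x≈y (λ _ → ≈-refl)) p

module _ {S : Setoid 0ℓ 0ℓ} (E : Exhaustible S) {P : Pred (Setoid.Carrier S) 0ℓ}
         (resp : P Respects Setoid._≈_ S) (P? : Decidable P) where

  private
    ¬P-resp : (¬_ ∘ P) Respects Setoid._≈_ S
    ¬P-resp x≈y ¬p p = ¬p (resp (Setoid.sym S x≈y) p)

    counterexample? : Dec (∃ (¬_ ∘ P))
    counterexample? = search E ¬P-resp (¬? ∘ P?)

    no-counterexample : ¬ ∃ (¬_ ∘ P) → ∀ x → P x
    no-counterexample ¬∃ x = decidable-stable (P? x) (λ ¬p → ¬∃ (x , ¬p))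

  ∀? : Dec (∀ x → P x)
  ∀? = Dec.map′ no-counterexample (λ ∀p (x , ¬p) → ¬p (∀p x)) (¬? counterexample?)

  ¬∀⇒∃¬ : ¬ (∀ x → P x) → ∃ (¬_ ∘ P)
  ¬∀⇒∃¬ ¬∀ = decidable-stable counterexample? (¬∀ ∘ no-counterexample)

module _ {P : Pred ℕ 0ℓ} (P? : Decidable P) where

  LeastBelow : ℕ → Set
  LeastBelow B = ∃ λ N → N ≤ B × P N × ∀ {N'} → P N' → N ≤ N'

  least-upTo : ∀ B → (∀ {N} → N ≤ B → ¬ P N) ⊎ LeastBelow B
  least-upTo zero with P? zero
  ... | yes p = inj₂ (zero , z≤n , p , λ _ → z≤n)
  ... | no ¬p = inj₁ λ { z≤n → ¬p }
  least-upTo (suc B) with least-upTo B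
  ... | inj₂ (N , N≤B , p , minimal) = inj₂ (N , m≤n⇒m≤1+n N≤B , p , minimal)
  ... | inj₁ none with P? (suc B)
  ...   | yes p =
    inj₂ (suc B , ≤-refl , p , λ p' → ≮⇒≥ λ N'<1+B → none (s≤s⁻¹ N'<1+B) p')
  ...   | no ¬p = inj₁ λ N≤1+B →
    [ none ∘ s≤s⁻¹ , (λ { refl → ¬p }) ] (m≤n⇒m<n∨m≡n N≤1+B)

  least : ∀ {B} → P B → LeastBelow B
  least {B} pB with least-upTo B
  ... | inj₁ none = ⊥-elim (none ≤-refl pB)
  ... | inj₂ minimum = minimum

¬¬-Π-Fin : ∀ {n} {P : Pred (Fin n) 0ℓ} → (∀ x → ¬ ¬ P x) → ¬ ¬ (∀ x → P x)
¬¬-Π-Fin {zero} _ k = k (λ ())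
¬¬-Π-Fin {suc n} ¬¬p k =
  ¬¬p zero λ p₀ → ¬¬-Π-Fin (¬¬p ∘ suc) λ ps → k λ { zero → p₀ ; (suc x) → ps x }

∃⊎∀ : ∀ {n} {A B : Fin n → Set} → (∀ x → A x ⊎ B x) → ∃ A ⊎ (∀ x → B x)
∃⊎∀ {zero} _ = inj₂ λ ()
∃⊎∀ {suc n} A⊎B with A⊎B zero | ∃⊎∀ (A⊎B ∘ suc)
... | inj₁ a | _ = inj₁ (zero , a)
... | inj₂ _ | inj₁ (x , a) = inj₁ (suc x , a)
... | inj₂ b | inj₂ bs = inj₂ λ { zero → b ; (suc x) → bs x }

≢-≢⇒≡ : ∀ {x y z : Bool} → x ≢ y → x ≢ z → y ≡ z
≢-≢⇒≡ x≢y x≢z = trans (¬-not (≡.≢-sym x≢y)) (≡.sym (¬-not (≡.≢-sym x≢z)))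

DecAdj : ∀ {n} → Graph n → Set
DecAdj G = ∀ i j → Dec (Adj G i j)

¬¬-DecAdj : ∀ {n} (G : Graph n) → ¬ ¬ DecAdj G
¬¬-DecAdj G = ¬¬-Π-Fin λ i → ¬¬-Π-Fin λ j → ¬¬-excluded-middle

K-dec : ∀ a → DecAdj (K a)
K-dec a i j = ¬? (i ≟ j)

J-dec : ∀ k → DecAdj (J k)
J-dec k i j = ¬? (i ≟ j) ×-dec ¬? edge01?
  where
    edge01? : Dec (IsEdge01 i j)
    edge01? = (toℕ i ≟ℕ 0 ×-dec toℕ j ≟ℕ 1) ⊎-dec (toℕ i ≟ℕ 1 ×-dec toℕ j ≟ℕ 0)

Injective? : ∀ {a b} (f : Fin a → Fin b) → Dec (Injective _≡_ _≡_ f)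
Injective? f = Dec.map′ (λ inj → inj _ _) (λ inj _ _ → inj)
  (all? λ x → all? λ y → (f x ≟ f y) →-dec (x ≟ y))

IsCopy : ∀ {n h} → Graph n → Graph h → (Fin n → Set) → (Fin h → Fin n) → Set
IsCopy G H X f =
  Injective _≡_ _≡_ f × (∀ a → X (f a)) × (∀ a b → Adj H a b → Adj G (f a) (f b))

module _ {n h} (G : Graph n) (H : Graph h) where

  ContainsIn-monoⱽ : ∀ {X Y : Fin n → Set} → (∀ {v} → X v → Y v) →
                     ContainsIn G H X → ContainsIn G H Y
  ContainsIn-monoⱽ X⊆Y (f , f-inj , f-X , f-adj) = f , f-inj , X⊆Y ∘ f-X , f-adj

  ContainsIn-monoᴱ : ∀ {G' : Graph n} {X} → (∀ {i j} → Adj G i j → Adj G' i j) →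
                     ContainsIn G H X → ContainsIn G' H X
  ContainsIn-monoᴱ G⊆G' (f , f-inj , f-X , f-adj) = f , f-inj , f-X , λ a b → G⊆G' ∘ f-adj a b

  IsCopy-respects : ∀ {X} →
                    IsCopy G H X Respects Setoid._≈_ (Pointwise.setoid (≡.setoid (Fin n)) h)
  IsCopy-respects {X} f≗g (f-inj , f-X , f-adj) =
    (λ {a} {b} e → f-inj (trans (f≗g a) (trans e (≡.sym (f≗g b))))) ,
    (λ a → subst X (f≗g a) (f-X a)) ,
    (λ a b ab → subst₂ (Adj G) (f≗g a) (f≗g b) (f-adj a b ab))

  ContainsIn? : ∀ {X} → DecAdj G → DecAdj H → Decidable X → Dec (ContainsIn G H X)
  ContainsIn? {X} dG dH X? = search (→-exhaustible Fin-exhaustible) (IsCopy-respects {X}) λ f →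
    Injective? f ×-dec
    all? (X? ∘ f) ×-dec
    all? (λ a → all? λ b → dH a b →-dec dG (f a) (f b))

module _ {n h₁ h₂} (G : Graph n) (H₁ : Graph h₁) (H₂ : Graph h₂) where

  ArrowsAt : (Fin n → Bool) → Set
  ArrowsAt c = ContainsIn G H₁ (λ v → c v ≡ true) ⊎ ContainsIn G H₂ (λ v → c v ≡ false)

  ArrowsAt-respects : ArrowsAt Respects Setoid._≈_ (Pointwise.setoid (≡.setoid Bool) n)
  ArrowsAt-respects c≗c' =
    map (ContainsIn-monoⱽ G H₁ λ {v} → trans (≡.sym (c≗c' v)))
        (ContainsIn-monoⱽ G H₂ λ {v} → trans (≡.sym (c≗c' v)))

  ArrowsAt? : DecAdj G → DecAdj H₁ → DecAdj H₂ → Decidable ArrowsAt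
  ArrowsAt? dG d₁ d₂ c =
    ContainsIn? G H₁ dG d₁ (λ v → c v ≟B true) ⊎-dec
    ContainsIn? G H₂ dG d₂ (λ v → c v ≟B false)

  Arrows? : DecAdj G → DecAdj H₁ → DecAdj H₂ → Dec (Arrows G H₁ H₂)
  Arrows? dG d₁ d₂ =
    ∀? (→-exhaustible Bool-exhaustible) ArrowsAt-respects (ArrowsAt? dG d₁ d₂)

module _ {n h} (G : Graph n) (H : Graph h) where

  Monochromatic : (Fin n → Bool) → Set
  Monochromatic c = ∃ λ b → ContainsIn G H (λ v → c v ≡ b)

  ArrowsAt⇒Monochromatic : ∀ {c} → ArrowsAt G H H c → Monochromatic c
  ArrowsAt⇒Monochromatic (inj₁ x) = true , x
  ArrowsAt⇒Monochromatic (inj₂ y) = false , y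

  Monochromatic⇒ArrowsAt : ∀ {c} → Monochromatic c → ArrowsAt G H H c
  Monochromatic⇒ArrowsAt (true , x) = inj₁ x
  Monochromatic⇒ArrowsAt (false , y) = inj₂ y

  ¬Arrows⇒bad-colouring : DecAdj G → DecAdj H → ¬ Arrows G H H →
                          ∃ λ c → ¬ Monochromatic c
  ¬Arrows⇒bad-colouring dG dH ¬arrows
    with ¬∀⇒∃¬ (→-exhaustible Bool-exhaustible) (ArrowsAt-respects G H H)
               (ArrowsAt? G H H dG dH dH) ¬arrows
  ... | c , ¬arrowsAt = c , ¬arrowsAt ∘ Monochromatic⇒ArrowsAt {c}

Arrows⇒vertex : ∀ {n h₁ h₂} {G : Graph n} {H₁ : Graph h₁} {H₂ : Graph h₂} →
                Arrows G H₁ H₂ → Fin h₁ → Fin h₂ → Fin n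
Arrows⇒vertex arrows a₁ a₂ with arrows (λ _ → true)
... | inj₁ (f , _) = f a₁
... | inj₂ (f , _) = f a₂

pullback : ∀ {N n} → (Fin N → Fin n) → Graph n → Graph N
pullback π G = record
  { Adj = λ x y → Adj G (π x) (π y) ; sym = Graph.sym G ; irrefl = Graph.irrefl G }

module _ {N n} (π : Fin N → Fin n) (G : Graph n) where

  pullback-dec : DecAdj G → DecAdj (pullback π G)
  pullback-dec dG x y = dG (π x) (π y)

  pullback-free : ∀ {k} → Free k G → Free k (pullback π G)
  pullback-free free (f , _ , _ , f-adj) = free (π ∘ f , πf-inj , _ , f-adj)
    where
      πf-inj : Injective _≡_ _≡_ (π ∘ f)
      πf-inj {a} {b} e with a ≟ b
      ... | yes a≡b = a≡b
      ... | no a≢b = ⊥-elim (Graph.irrefl G (subst (Adj G _) (≡.sym e) (f-adj a b a≢b)))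

Matrix : ℕ → Set
Matrix N = Fin N → Fin N → Bool

fromMatrix : ∀ {N} → Matrix N → Graph N
fromMatrix M = record
  { Adj = λ i j → i ≢ j × T (M i j) × T (M j i)
  ; sym = λ (i≢j , Mij , Mji) → ≡.≢-sym i≢j , Mji , Mij
  ; irrefl = λ (i≢i , _) → i≢i refl }

fromMatrix-dec : ∀ {N} (M : Matrix N) → DecAdj (fromMatrix M)
fromMatrix-dec M i j = ¬? (i ≟ j) ×-dec T? (M i j) ×-dec T? (M j i)

fromMatrix-cong : ∀ {N} {M M' : Matrix N} → (∀ i j → M i j ≡ M' i j) →
                  ∀ {i j} → Adj (fromMatrix M) i j → Adj (fromMatrix M') i j
fromMatrix-cong M≗M' {i} {j} (i≢j , Mij , Mji) =
  i≢j , subst T (M≗M' i j) Mij , subst T (M≗M' j i) Mji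

module _ {N} (G : Graph N) (dG : DecAdj G) where

  toMatrix : Matrix N
  toMatrix i j = isYes (dG i j)

  toMatrix-⊇ : ∀ {i j} → Adj G i j → Adj (fromMatrix toMatrix) i j
  toMatrix-⊇ Gij =
    (λ { refl → Graph.irrefl G Gij }) , fromWitness Gij , fromWitness (Graph.sym G Gij)

  toMatrix-⊆ : ∀ {i j} → Adj (fromMatrix toMatrix) i j → Adj G i j
  toMatrix-⊆ (_ , Mij , _) = toWitness Mij

FvGraph : ∀ {N h₁ h₂} → Graph h₁ → Graph h₂ → ℕ → Graph N → Set
FvGraph H₁ H₂ m G = Free m G × Arrows G H₁ H₂

module _ {h₁ h₂} (H₁ : Graph h₁) (H₂ : Graph h₂) (m : ℕ) where

  FvGraph-transport : ∀ {N} (G G' : Graph N) →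
    (∀ {i j} → Adj G i j → Adj G' i j) → (∀ {i j} → Adj G' i j → Adj G i j) →
    FvGraph H₁ H₂ m G → FvGraph H₁ H₂ m G'
  FvGraph-transport G G' G⊆G' G'⊆G (free , arrows) =
    free ∘ ContainsIn-monoᴱ G' (K m) {G} {λ _ → ⊤} G'⊆G ,
    λ c → map (ContainsIn-monoᴱ G H₁ {G'} {λ v → c v ≡ true} G⊆G')
              (ContainsIn-monoᴱ G H₂ {G'} {λ v → c v ≡ false} G⊆G') (arrows c)

  FvMatrix : ℕ → Set
  FvMatrix N = ∃ λ (M : Matrix N) → FvGraph H₁ H₂ m (fromMatrix M)

  FvMatrix? : DecAdj H₁ → DecAdj H₂ → Decidable FvMatrix
  FvMatrix? d₁ d₂ N =
    search (→-exhaustible (→-exhaustible Bool-exhaustible))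
      (λ {M} {M'} M≗M' → FvGraph-transport (fromMatrix M) (fromMatrix M')
                           (fromMatrix-cong M≗M') (fromMatrix-cong λ i j → ≡.sym (M≗M' i j)))
      λ M → ¬? (ContainsIn? (fromMatrix M) (K m) (fromMatrix-dec M) (K-dec m) λ _ → yes tt) ×-dec
            Arrows? (fromMatrix M) H₁ H₂ (fromMatrix-dec M) d₁ d₂

  FvGraph⇒FvMatrix : ∀ {N} (G : Graph N) → FvGraph H₁ H₂ m G → DecAdj G → FvMatrix N
  FvGraph⇒FvMatrix G fv dG = toMatrix G dG ,
    FvGraph-transport G (fromMatrix (toMatrix G dG)) (toMatrix-⊇ G dG) (toMatrix-⊆ G dG) fv

  -- Adjacency in a Graph is an arbitrary Set, so a graph is only ¬¬-equivalent to a Boolean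
  -- matrix; this suffices because both the search and the comparison N ≤ N' are decidable.
  IsFv-exists : DecAdj H₁ → DecAdj H₂ → ∀ {B} → ¬ ¬ Σ (Graph B) (FvGraph H₁ H₂ m) →
                Σ ℕ λ N → IsFv H₁ H₂ m N × N ≤ B
  IsFv-exists d₁ d₂ {B} ¬¬witness
    with least (FvMatrix? d₁ d₂) (decidable-stable (FvMatrix? d₁ d₂ B)
           λ ¬M → ¬¬witness λ (G , fv) → ¬¬-DecAdj G (¬M ∘ FvGraph⇒FvMatrix G fv))
  ... | N , N≤B , (M , fv) , minimal = N , ((fromMatrix M , fv) , lower-bound) , N≤B
    where
      lower-bound : ∀ N' (G : Graph N') → Free m G → Arrows G H₁ H₂ → N ≤ N'
      lower-bound N' G free arrows = decidable-stable (N ≤? N')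
        λ N≰N' → ¬¬-DecAdj G (N≰N' ∘ minimal ∘ FvGraph⇒FvMatrix G (free , arrows))

collapse : ∀ {r} → Fin (suc r) → Fin (suc (suc r)) → Fin (suc r)
collapse a₀ 0F = a₀
collapse a₀ 1F = a₀
collapse a₀ (suc (suc j)) = punchIn a₀ j

collapse-fibres : ∀ {r} (a₀ : Fin (suc r)) x y → collapse a₀ x ≡ collapse a₀ y →
                  x ≡ y ⊎ (x ≡ 0F × y ≡ 1F) ⊎ (x ≡ 1F × y ≡ 0F)
collapse-fibres a₀ 0F 0F _ = inj₁ refl
collapse-fibres a₀ 0F 1F _ = inj₂ (inj₁ (refl , refl))
collapse-fibres a₀ 0F (suc (suc j)) e = ⊥-elim (punchInᵢ≢i a₀ j (≡.sym e))
collapse-fibres a₀ 1F 0F _ = inj₂ (inj₂ (refl , refl))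
collapse-fibres a₀ 1F 1F _ = inj₁ refl
collapse-fibres a₀ 1F (suc (suc j)) e = ⊥-elim (punchInᵢ≢i a₀ j (≡.sym e))
collapse-fibres a₀ (suc (suc i)) 0F e = ⊥-elim (punchInᵢ≢i a₀ i e)
collapse-fibres a₀ (suc (suc i)) 1F e = ⊥-elim (punchInᵢ≢i a₀ i e)
collapse-fibres a₀ (suc (suc i)) (suc (suc j)) e =
  inj₁ (cong (λ k → suc (suc k)) (punchIn-injective a₀ i j e))

collapse-hom : ∀ {r} (a₀ : Fin (suc r)) x y → Adj (J (suc (suc r))) x y →
               Adj (K (suc r)) (collapse a₀ x) (collapse a₀ y)
collapse-hom a₀ x y (x≢y , ¬edge) e with collapse-fibres a₀ x y e
... | inj₁ x≡y = x≢y x≡y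
... | inj₂ (inj₁ (refl , refl)) = ¬edge (inj₁ (refl , refl))
... | inj₂ (inj₂ (refl , refl)) = ¬edge (inj₂ (refl , refl))

module _ {N n} (π : Fin N → Fin n) (X : Fin N → Set) where

  Lift : Fin n → Set
  Lift v = ∃ λ p → π p ≡ v × X p

  TwoLifts : Fin n → Set
  TwoLifts v = ∃₂ λ p q → p ≢ q × (π p ≡ v × X p) × (π q ≡ v × X q)

  module _ (G : Graph n) where

    copy-lifts : ∀ {h} {H : Graph h} {Y} (g : Fin h → Fin n) → IsCopy G H Y g →
                 (∀ a → Lift (g a)) → ContainsIn (pullback π G) H X
    copy-lifts {H = H} g (g-inj , _ , g-adj) lift =
      proj₁ ∘ lift , lift-inj , proj₂ ∘ proj₂ ∘ lift , lift-adj
      where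
        π-lift : ∀ a → π (proj₁ (lift a)) ≡ g a
        π-lift a = proj₁ (proj₂ (lift a))
        lift-inj : Injective _≡_ _≡_ (proj₁ ∘ lift)
        lift-inj {a} {b} e = g-inj (trans (≡.sym (π-lift a)) (trans (cong π e) (π-lift b)))
        lift-adj : ∀ a b → Adj H a b → Adj G (π (proj₁ (lift a))) (π (proj₁ (lift b)))
        lift-adj a b ab = subst₂ (Adj G) (≡.sym (π-lift a)) (≡.sym (π-lift b)) (g-adj a b ab)

    -- The two lifts of g a₀ become the ends of the missing edge of J; the other vertices of J
    -- are lifts of the remaining clique vertices, so collapse describes the projection to G.
    J-in-pullback : ∀ {r} (g : Fin (suc r) → Fin n) → IsCopy G (K (suc r)) Lift g →
                    ∀ a₀ → TwoLifts (g a₀) → ContainsIn (pullback π G) (J (suc (suc r))) X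
    J-in-pullback {r} g (g-inj , lift , g-adj) a₀ (p , q , p≢q , (πp , Xp) , (πq , Xq)) =
      F , F-inj , F-X , F-adj
      where
        F : Fin (suc (suc r)) → Fin N
        F 0F = p
        F 1F = q
        F (suc (suc j)) = proj₁ (lift (punchIn a₀ j))

        F-X : ∀ x → X (F x)
        F-X 0F = Xp
        F-X 1F = Xq
        F-X (suc (suc j)) = proj₂ (proj₂ (lift (punchIn a₀ j)))

        πF : ∀ x → π (F x) ≡ g (collapse a₀ x)
        πF 0F = πp
        πF 1F = πq
        πF (suc (suc j)) = proj₁ (proj₂ (lift (punchIn a₀ j)))

        F-inj : Injective _≡_ _≡_ F
        F-inj {x} {y} e
          with collapse-fibres a₀ x y (g-inj (trans (≡.sym (πF x)) (trans (cong π e) (πF y))))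
        ... | inj₁ x≡y = x≡y
        ... | inj₂ (inj₁ (refl , refl)) = ⊥-elim (p≢q e)
        ... | inj₂ (inj₂ (refl , refl)) = ⊥-elim (p≢q (≡.sym e))

        F-adj : ∀ x y → Adj (J (suc (suc r))) x y → Adj G (π (F x)) (π (F y))
        F-adj x y xy =
          subst₂ (Adj G) (≡.sym (πF x)) (≡.sym (πF y)) (g-adj _ _ (collapse-hom a₀ x y xy))

module Doubling {m} (G : Graph (suc m)) where

  π : Fin (suc (2 * suc m)) → Fin (suc m)
  π zero = zero
  π (suc x) = remainder {2} (suc m) x

  copy : Fin 2 → Fin (suc m) → Fin (suc (2 * suc m))
  copy b v = suc (combine b v)

  π-copy : ∀ b v → π (copy b v) ≡ v
  π-copy b v = cong proj₂ (remQuot-combine {2} b v)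

  copies-distinct : ∀ v → copy 0F v ≢ copy 1F v
  copies-distinct v e with combine-injectiveˡ {2} 0F v 1F v (suc-injective e)
  ... | ()

  doubled : Graph (suc (2 * suc m))
  doubled = pullback π G

  module _ (d : Fin m → Bool) (c : Fin (suc (2 * suc m)) → Bool) where

    Coloured : Bool → Fin (suc (2 * suc m)) → Set
    Coloured b p = c p ≡ b

    FibreColour : Fin (suc m) → Bool → Set
    FibreColour v b =
      Lift π (Coloured b) v × (TwoLifts π (Coloured b) v ⊎ ∃ λ i → v ≡ suc i × b ≡ d i)

    same-colour : ∀ {v} p q → p ≢ q → π p ≡ v → π q ≡ v → c p ≡ c q →
                  ∃ (FibreColour v)
    same-colour p q p≢q πp πq cp≡cq =
      c p , (p , πp , refl) , inj₁ (p , q , p≢q , (πp , refl) , (πq , ≡.sym cp≡cq))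

    both-copies : ∀ v → c (copy 0F v) ≡ c (copy 1F v) → ∃ (FibreColour v)
    both-copies v = same-colour (copy 0F v) (copy 1F v) (copies-distinct v) (π-copy 0F v) (π-copy 1F v)

    apex-and-copy : ∀ b → c zero ≡ c (copy b zero) → ∃ (FibreColour zero)
    apex-and-copy b = same-colour zero (copy b zero) (λ ()) refl (π-copy b zero)

    d-coloured : ∀ {i} b → c (copy b (suc i)) ≡ d i → ∃ (FibreColour (suc i))
    d-coloured {i} b cp = d i , (copy b (suc i) , π-copy b (suc i) , cp) , inj₂ (i , refl , refl)

    fibre-colour : ∀ v → ∃ (FibreColour v)
    fibre-colour zero with c zero ≟B c (copy 0F zero) | c zero ≟B c (copy 1F zero)
    ... | yes e | _ = apex-and-copy 0F e
    ... | no _ | yes e = apex-and-copy 1F e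
    ... | no e₀ | no e₁ = both-copies zero (≢-≢⇒≡ e₀ e₁)
    fibre-colour (suc i) with c (copy 0F (suc i)) ≟B c (copy 1F (suc i)) | c (copy 0F (suc i)) ≟B d i
    ... | yes e | _ = both-copies (suc i) e
    ... | no _ | yes e = d-coloured 0F e
    ... | no e₀₁ | no e₀d = d-coloured 1F (≢-≢⇒≡ e₀₁ e₀d)

    colour : Fin (suc m) → Bool
    colour v = proj₁ (fibre-colour v)

    colour-lift : ∀ {v b} → colour v ≡ b → Lift π (Coloured b) v
    colour-lift {v} refl = proj₁ (proj₂ (fibre-colour v))

    monochromatic-clique⇒J : ∀ {r b} (g : Fin (suc r) → Fin (suc m)) →
      IsCopy G (K (suc r)) (λ v → colour v ≡ b) g →
      ¬ Monochromatic (pullback suc G) (K (suc r)) d →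
      ContainsIn doubled (J (suc (suc r))) (Coloured b)
    monochromatic-clique⇒J {r} {b} g g-copy@(g-inj , g-colour , g-adj) d-bad
      with ∃⊎∀ (λ a → proj₂ (proj₂ (fibre-colour (g a))))
    ... | inj₁ (a₀ , two-lifts) =
      J-in-pullback π (Coloured b) G g (g-inj , (λ a → colour-lift (g-colour a)) , g-adj) a₀
        (subst (λ b' → TwoLifts π (Coloured b') (g a₀)) (g-colour a₀) two-lifts)
    ... | inj₂ d-coloured =
      ⊥-elim (d-bad (b ,
        copy-lifts suc (λ i → d i ≡ b) G {H = K (suc r)} {Y = λ v → colour v ≡ b} g g-copy lift))
      where
        lift : ∀ a → Lift suc (λ i → d i ≡ b) (g a)
        lift a = let i , gₐ≡1+i , colour≡dᵢ = d-coloured a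
                 in i , ≡.sym gₐ≡1+i , trans (≡.sym colour≡dᵢ) (g-colour a)

  doubled-arrows : ∀ {r} → Arrows G (K (suc r)) (K (suc r)) →
    ∀ d → ¬ Monochromatic (pullback suc G) (K (suc r)) d →
    Arrows doubled (J (suc (suc r))) (J (suc (suc r)))
  doubled-arrows {r} arrows d d-bad c
    with ArrowsAt⇒Monochromatic G (K (suc r)) {colour d c} (arrows (colour d c))
  ... | b , g , g-copy = Monochromatic⇒ArrowsAt doubled (J (suc (suc r))) {c}
                           (b , monochromatic-clique⇒J d c g g-copy d-bad)

2n+1≤⌈5n/2⌉ : ∀ m → suc (2 * suc m) ≤ ceil5/2 (suc m)
2n+1≤⌈5n/2⌉ m = begin
  suc (2 * suc m)          ≡⟨ m*n/n≡m (suc (2 * suc m)) 2 ⟨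
  suc (2 * suc m) * 2 / 2  ≤⟨ /-monoˡ-≤ 2 (subst₂ _≤_ (lhs m) (rhs m) (m≤n+m _ m)) ⟩
  (5 * suc m + 1) / 2      ∎
  where
    open ≤-Reasoning
    lhs : ∀ m → 4 * m + 6 ≡ suc (2 * suc m) * 2
    lhs = solve-∀
    rhs : ∀ m → m + (4 * m + 6) ≡ 5 * suc m + 1
    rhs = solve-∀

corollary7 : ∀ (k : ℕ) → 2 ≤ k → ∀ (n : ℕ) → IsFv (K (k ∸ 1)) (K (k ∸ 1)) k n →
    Σ ℕ λ N → IsFv (J k) (J k) k N × N ≤ ceil5/2 n
corollary7 (suc (suc r)) (s≤s (s≤s z≤n)) zero ((G , _ , arrows) , _) =
  ⊥-elim (¬Fin0 (Arrows⇒vertex {G = G} {K (suc r)} {K (suc r)} arrows zero zero))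
corollary7 k@(suc (suc r)) (s≤s (s≤s z≤n)) (suc m) ((G , free , arrows) , minimal) =
  let N , isFv , N≤2n+1 =
        IsFv-exists (J k) (J k) k (J-dec k) (J-dec k) (¬¬-map doubled-FvGraph (¬¬-DecAdj G))
  in N , isFv , ≤-trans N≤2n+1 (2n+1≤⌈5n/2⌉ m)
  where
    open Doubling G

    G-0-¬arrows : ¬ Arrows (pullback suc G) (K (suc r)) (K (suc r))
    G-0-¬arrows G-0-arrows =
      1+n≰n (minimal m (pullback suc G) (pullback-free suc G free) G-0-arrows)

    doubled-FvGraph : DecAdj G → Σ (Graph (suc (2 * suc m))) (FvGraph (J k) (J k) k)
    doubled-FvGraph dG = doubled , pullback-free π G free , uncurry (doubled-arrows arrows)
      (¬Arrows⇒bad-colouring (pullback suc G) (K (suc r))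
        (pullback-dec suc G dG) (K-dec (suc r)) G-0-¬arrows)
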